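{- Let $\mathcal{P}$ be a finite set of propositional symbols and $\varphi$ an $\mathrm{LDL}_f$ formula over $\mathcal{P}$. Let $\mathsf{pref}_{\varphi}$ and $\mathsf{pref}_{\neg\varphi}$ be regular expressions over $2^{\mathcal{P}}$ (built from propositional formulae with $+$, $;$, $^*$, without tests) with $\mathcal{L}(\mathsf{pref}_{\varphi})=\mathcal{L}_{\mathit{poss\_good}}(\varphi)$ and $\mathcal{L}(\mathsf{pref}_{\neg\varphi})=\mathcal{L}_{\mathit{poss\_good}}(\neg\varphi)$. Then for every finite trace $\pi$: (1) $\pi\in\mathcal{L}_{\mathit{poss\_good}}(\varphi)$ iff $\pi\models\langle\mathsf{pref}_{\varphi}\rangle\mathit{end}$; (2) $\pi\in\mathcal{L}_{\mathit{nec\_good}}(\varphi)$ iff $\pi\models\langle\mathsf{pref}_{\varphi}\rangle\mathit{end}\wedge\neg\langle\mathsf{pref}_{\neg\varphi}\rangle\mathit{end}$.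
   Context: A trace is a finite, possibly empty, sequence $\pi=\pi_0,\dots,\pi_n$ of elements of $2^{\mathcal{P}}$; $\mathit{length}(\pi)=n+1$ ($0$ for the empty trace $\epsilon$), $\pi(i)=\pi_i$, and $\pi(i,j)=\pi_i,\dots,\pi_{j-1}$ (equal to $\pi(i,\mathit{length}(\pi))$ if $j>\mathit{length}(\pi)$, and to $\epsilon$ if $j\le i$). $\pi\pi'$ denotes concatenation of traces. $\mathrm{LDL}_f$ formulae and path expressions are given by $\varphi ::= \mathtt{true}\mid\mathtt{false}\mid\neg\varphi\mid\varphi_1\wedge\varphi_2\mid\varphi_1\vee\varphi_2\mid\langle\rho\rangle\varphi\mid[\rho]\varphi$ and $\rho ::= \phi\mid\varphi?\mid\rho_1+\rho_2\mid\rho_1;\rho_2\mid\rho^*$, where $\phi$ ranges over propositional formulae over $\mathcal{P}$. Semantics at position $i\ge 0$: $\pi,i\models\mathtt{true}$; $\pi,i\not\models\mathtt{false}$; Boolean connectives as usual; $\pi,i\models\langle\rho\rangle\varphi$ iff for some $j\ge i$, $\pi(i,j)\in\mathcal{L}(\rho)$ and $\pi,j\models\varphi$; $\pi,i\models[\rho]\varphi$ iff for all $j\ge i$ with $\pi(i,j)\in\mathcal{L}(\rho)$, $\pi,j\models\varphi$. Here $\pi(i,j)\in\mathcal{L}(\phi)$ iff $j=i+1$, $i<\mathit{length}(\pi)$ and $\pi(i)\models\phi$; $\pi(i,j)\in\mathcal{L}(\varphi?)$ iff $j=i$ and $\pi,i\models\varphi$; $\pi(i,j)\in\mathcal{L}(\rho_1+\rho_2)$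 iff it is in $\mathcal{L}(\rho_1)$ or $\mathcal{L}(\rho_2)$; $\pi(i,j)\in\mathcal{L}(\rho_1;\rho_2)$ iff for some $k$, $\pi(i,k)\in\mathcal{L}(\rho_1)$ and $\pi(k,j)\in\mathcal{L}(\rho_2)$; $\pi(i,j)\in\mathcal{L}(\rho^*)$ iff $j=i$ or for some $k$, $\pi(i,k)\in\mathcal{L}(\rho)$ and $\pi(k,j)\in\mathcal{L}(\rho^*)$. We write $\pi\models\varphi$ for $\pi,0\models\varphi$, and $\mathcal{L}(\varphi)=\{\pi\mid\pi\models\varphi\}$. The abbreviation $\mathit{end}$ stands for $[\mathit{true}]\mathtt{false}$ ($\mathit{true}$ the propositional tautology). For a test-free regular expression $\rho$, $\mathcal{L}(\rho)$ also denotes its usual language of finite traces (a propositional formula $\phi$ matches the one-letter traces $\Pi$ with $\Pi\models\phi$). Prefix languages: $\mathcal{L}_{\mathit{poss\_good}}(\varphi)=\{\pi\mid \exists\pi'.\ \pi\pi'\in\mathcal{L}(\varphi)\}$; $\mathcal{L}_{\mathit{nec\_good}}(\varphi)=\{\pi\mid \forall\pi'.\ \pi\pi'\in\mathcal{L}(\varphi)\}$ ($\pi'$ ranges over finite traces, including $\epsilon$). -}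

module Defs where

open import Data.Nat using (ℕ; suc; _<_; _≤_)
open import Data.Fin using (Fin)
open import Data.Bool using (Bool; true; false; T)
open import Data.List using (List; []; _∷_; _++_; length; lookup)
open import Data.Product using (Σ; ∃; _×_; _,_)
open import Data.Sum using (_⊎_)
open import Data.Unit using (⊤)
open import Data.Empty using (⊥)
open import Relation.Nullary using (¬_)
open import Relation.Binary.PropositionalEquality using (_≡_)

-- Propositional symbols P = Fin n (a finite set); a letter is an element of 2^P.
Letter : ℕ → Set
Letter n = Fin n → Bool

Trace : ℕ → Set
Trace n = List (Letter n)

data PropF (n : ℕ) : Set where
  atom  : Fin n → PropF n
  ptrue pfalse : PropF n
  pnot  : PropF n → PropF n
  pand por : PropF n → PropF n → PropF n

_⊨p_ : ∀ {n} → Letter n → PropF n → Set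
Π ⊨p atom p = T (Π p)
Π ⊨p ptrue = ⊤
Π ⊨p pfalse = ⊥
Π ⊨p pnot φ = ¬ (Π ⊨p φ)
Π ⊨p pand φ ψ = (Π ⊨p φ) × (Π ⊨p ψ)
Π ⊨p por φ ψ = (Π ⊨p φ) ⊎ (Π ⊨p ψ)

mutual
  data Form (n : ℕ) : Set where
    tt ff : Form n
    neg : Form n → Form n
    and or : Form n → Form n → Form n
    dia box : Path n → Form n → Form n

  data Path (n : ℕ) : Set where
    prop : PropF n → Path n
    test : Form n → Path n
    _+ₚ_ _⨾ₚ_ : Path n → Path n → Path n
    star : Path n → Path n

data Star (R : ℕ → ℕ → Set) : ℕ → ℕ → Set where
  ε   : ∀ {i} → Star R i i
  _◅_ : ∀ {i k j} → R i k → Star R k j → Star R i j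

mutual
  Sat : ∀ {n} → Trace n → ℕ → Form n → Set
  Sat π i tt = ⊤
  Sat π i ff = ⊥
  Sat π i (neg φ) = ¬ Sat π i φ
  Sat π i (and φ ψ) = Sat π i φ × Sat π i ψ
  Sat π i (or φ ψ) = Sat π i φ ⊎ Sat π i ψ
  Sat π i (dia ρ φ) = Σ ℕ λ j → i ≤ j × InL π i j ρ × Sat π j φ
  Sat π i (box ρ φ) = (j : ℕ) → i ≤ j → InL π i j ρ → Sat π j φ

  InL : ∀ {n} → Trace n → ℕ → ℕ → Path n → Set
  InL π i j (prop φ) =
    j ≡ suc i × Σ (i < length π) λ lt → lookup π (Data.Fin.fromℕ< lt) ⊨p φ
  InL π i j (test φ) = j ≡ i × Sat π i φ
  InL π i j (ρ₁ +ₚ ρ₂) = InL π i j ρ₁ ⊎ InL π i j ρ₂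
  InL π i j (ρ₁ ⨾ₚ ρ₂) = Σ ℕ λ k → InL π i k ρ₁ × InL π k j ρ₂
  InL π i j (star ρ) = Star (λ a b → InL π a b ρ) i j

_⊨_ : ∀ {n} → Trace n → Form n → Set
π ⊨ φ = Sat π 0 φ

end : ∀ {n} → Form n
end = box (prop ptrue) ff

data RE (n : ℕ) : Set where
  rprop : PropF n → RE n
  _+ᵣ_ _⨾ᵣ_ : RE n → RE n → RE n
  rstar : RE n → RE n

data StarL {n} (M : Trace n → Set) : Trace n → Set where
  nil  : StarL M []
  cons : ∀ π₁ π₂ → M π₁ → StarL M π₂ → StarL M (π₁ ++ π₂)

InRE : ∀ {n} → RE n → Trace n → Set
InRE (rprop φ) π = Σ (Letter _) λ Π → π ≡ Π ∷ [] × Π ⊨p φ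
InRE (r₁ +ᵣ r₂) π = InRE r₁ π ⊎ InRE r₂ π
InRE (r₁ ⨾ᵣ r₂) π = Σ (Trace _) λ π₁ → Σ (Trace _) λ π₂ →
  π ≡ π₁ ++ π₂ × InRE r₁ π₁ × InRE r₂ π₂
InRE (rstar r) π = StarL (InRE r) π

toPath : ∀ {n} → RE n → Path n
toPath (rprop φ) = prop φ
toPath (r₁ +ᵣ r₂) = toPath r₁ +ₚ toPath r₂
toPath (r₁ ⨾ᵣ r₂) = toPath r₁ ⨾ₚ toPath r₂
toPath (rstar r) = star (toPath r)

PossGood : ∀ {n} → Form n → Trace n → Set
PossGood φ π = Σ (Trace _) λ π' → (π ++ π') ⊨ φ

NecGood : ∀ {n} → Form n → Trace n → Set
NecGood φ π = (π' : Trace _) → (π ++ π') ⊨ φ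

module Submission where

-- Both parts rest on one observation about test-free regular expressions
-- r viewed as path expressions: a trace π satisfies ⟨r⟩end exactly when
-- π ∈ L(r), because the paths of r starting at 0 read prefixes of π that are
-- words of L(r), and end holds only at position length π.  Part (1) is this
-- fact for r = pref_φ.  For part (2) we show that π is necessarily good for φ
-- iff it is possibly good for φ and not possibly good for ¬φ; the backward
-- direction needs ¬¬(π π' ⊨ φ) → π π' ⊨ φ, so we prove that LDL_f
-- satisfaction on finite traces is decidable.

open import Defs
open import Data.Nat using (ℕ; zero; suc; pred; _+_; _∸_; _⊔_; _≤_; _<_; z≤n; s≤s; _≟_; _<?_)
open import Data.Nat.Properties
open import Data.Fin using (fromℕ<)
open import Data.Bool using (T?)
open import Data.List using (List; []; _∷_; _++_; length; lookup; drop)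
open import Data.List.Properties using (++-assoc; ++-identityʳ; length-++; drop-drop)
open import Data.Product using (Σ; ∃; _×_; _,_; proj₁; proj₂)
open import Data.Product.Function.NonDependent.Propositional using (_×-⇔_)
open import Data.Sum using (inj₁; inj₂)
open import Data.Unit using () renaming (tt to ⋆)
open import Data.Empty using (⊥-elim)
open import Relation.Nullary using (¬_; Dec; yes; no)
open import Relation.Nullary.Decidable using (¬?; _×-dec_; _⊎-dec_; _→-dec_; map′; decidable-stable)
open import Relation.Binary.PropositionalEquality using (_≡_; refl; sym; trans; cong; subst; module ≡-Reasoning)
open import Function using (_∘_)
open import Function.Bundles using (_⇔_; mk⇔; Equivalence)
open import Function.Construct.Composition using (_⇔-∘_)
open import Function.Construct.Symmetry using (⇔-sym)

¬-⇔ : ∀ {A B : Set} → A ⇔ B → (¬ A) ⇔ (¬ B)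
¬-⇔ A⇔B = mk⇔ (λ ¬a b → ¬a (Equivalence.from A⇔B b)) (λ ¬b a → ¬b (Equivalence.to A⇔B a))

_⊨p?_ : ∀ {n} (Π : Letter n) (φ : PropF n) → Dec (Π ⊨p φ)
Π ⊨p? atom p = T? (Π p)
Π ⊨p? ptrue = yes ⋆
Π ⊨p? pfalse = no λ ()
Π ⊨p? pnot φ = ¬? (Π ⊨p? φ)
Π ⊨p? pand φ ψ = (Π ⊨p? φ) ×-dec (Π ⊨p? ψ)
Π ⊨p? por φ ψ = (Π ⊨p? φ) ⊎-dec (Π ⊨p? ψ)

∃-bounded? : ∀ {Q : ℕ → Set} B → (∀ {k} → Q k → k < B) → (∀ k → Dec (Q k)) → Dec (∃ Q)
∃-bounded? B bound Q? =
  map′ (λ (k , _ , q) → k , q) (λ (k , q) → k , bound q , q) (anyUpTo? Q? B)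

∀-bounded? : ∀ {A P : ℕ → Set} B → (∀ {k} → A k → k < B) →
             (∀ k → Dec (A k)) → (∀ k → Dec (P k)) → Dec (∀ k → A k → P k)
∀-bounded? B bound A? P? =
  map′ (λ h k a → h (bound a) a) (λ h {k} _ → h k) (allUpTo? (λ k → A? k →-dec P? k) B)

-- Within L i j: the range containing every position j that a path expression
-- can lead to from i on a trace of length L.  Paths never move backwards,
-- and they move forward only by reading letters, i.e. not beyond L.
Within : ℕ → ℕ → ℕ → Set
Within L i j = i ≤ j × j ≤ i ⊔ L

within-trans : ∀ {L i k j} → Within L i k → Within L k j → Within L i j
within-trans {L} {i} (i≤k , k≤i⊔L) (k≤j , j≤k⊔L) =
  ≤-trans i≤k k≤j , ≤-trans j≤k⊔L (⊔-lub k≤i⊔L (m≤n⊔m i L))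

mutual
  inL-within : ∀ {n} (π : Trace n) {i j} ρ → InL π i j ρ → Within (length π) i j
  inL-within π {i} (prop φ) (refl , i<L , _) = n≤1+n i , ≤-trans i<L (m≤n⊔m i (length π))
  inL-within π {i} (test φ) (refl , _) = ≤-refl , m≤m⊔n i (length π)
  inL-within π (ρ₁ +ₚ ρ₂) (inj₁ x) = inL-within π ρ₁ x
  inL-within π (ρ₁ +ₚ ρ₂) (inj₂ x) = inL-within π ρ₂ x
  inL-within π (ρ₁ ⨾ₚ ρ₂) (k , x , y) = within-trans (inL-within π ρ₁ x) (inL-within π ρ₂ y)
  inL-within π (star ρ) s = star-within π ρ s

  star-within : ∀ {n} (π : Trace n) ρ {i j} → Star (λ a b → InL π a b ρ) i j → Within (length π) i j
  star-within π ρ {i} ε = ≤-refl , m≤m⊔n i (length π)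
  star-within π ρ (r ◅ s) = within-trans (inL-within π ρ r) (star-within π ρ s)

-- The bound used to make the quantifiers of the semantics finite.
inL-bound : ∀ {n} (π : Trace n) {i j} ρ → InL π i j ρ → j < suc (i ⊔ length π)
inL-bound π ρ x = s≤s (proj₂ (inL-within π ρ x))

-- For a non-decreasing R, Star R and
-- Star (Progress R) relate the same positions, and the latter is decidable
-- because each step strictly shortens the remaining distance.
Progress : (ℕ → ℕ → Set) → ℕ → ℕ → Set
Progress R a b = a < b × R a b

module _ {R : ℕ → ℕ → Set} where

  drop-loops : (∀ {a b} → R a b → a ≤ b) → ∀ {i j} → Star R i j → Star (Progress R) i j
  drop-loops mono ε = ε
  drop-loops mono (r ◅ s) with m≤n⇒m<n∨m≡n (mono r)
  ... | inj₁ a<b = (a<b , r) ◅ drop-loops mono s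
  ... | inj₂ refl = drop-loops mono s

  forget-progress : ∀ {i j} → Star (Progress R) i j → Star R i j
  forget-progress ε = ε
  forget-progress ((_ , r) ◅ s) = r ◅ forget-progress s

  progress-≤ : ∀ {i j} → Star (Progress R) i j → i ≤ j
  progress-≤ ε = ≤-refl
  progress-≤ ((a<b , _) ◅ s) = ≤-trans (<⇒≤ a<b) (progress-≤ s)

  -- the distance j ∸ i, bounded by f, serves as fuel
  progress? : (∀ a b → Dec (R a b)) → ∀ f i j → j ∸ i ≤ f → Dec (Star (Progress R) i j)
  progress? R? f i j fuel with i ≟ j
  ... | yes refl = yes ε
  progress? R? zero i j fuel | no i≢j =
    no λ s → i≢j (≤-antisym (progress-≤ s) (m∸n≡0⇒m≤n (n≤0⇒n≡0 fuel)))
  progress? R? (suc f) i j fuel | no i≢j =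
    map′ (λ (_ , p , s) → p ◅ s) first-step
         (∃-bounded? (suc j) (λ (_ , s) → s≤s (progress-≤ s)) first-step?)
    where
    fuel-step : ∀ {k} → i < k → j ∸ k ≤ f
    fuel-step {k} i<k = begin
      j ∸ k          ≤⟨ ∸-monoʳ-≤ j i<k ⟩
      j ∸ suc i      ≡⟨ pred[m∸n]≡m∸[1+n] j i ⟨
      pred (j ∸ i)   ≤⟨ pred-mono-≤ fuel ⟩
      f              ∎
      where open ≤-Reasoning

    first-step? : ∀ k → Dec (Progress R i k × Star (Progress R) k j)
    first-step? k with i <? k
    ... | no i≮k = no (i≮k ∘ proj₁ ∘ proj₁)
    ... | yes i<k = map′ (λ (r , s) → (i<k , r) , s) (λ ((_ , r) , s) → r , s)
                         (R? i k ×-dec progress? R? f k j (fuel-step i<k))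

    first-step : Star (Progress R) i j → ∃ λ k → Progress R i k × Star (Progress R) k j
    first-step ε = ⊥-elim (i≢j refl)
    first-step (p ◅ s) = _ , p , s

mutual
  Sat? : ∀ {n} (π : Trace n) i φ → Dec (Sat π i φ)
  Sat? π i tt = yes ⋆
  Sat? π i ff = no λ ()
  Sat? π i (neg φ) = ¬? (Sat? π i φ)
  Sat? π i (and φ ψ) = Sat? π i φ ×-dec Sat? π i ψ
  Sat? π i (or φ ψ) = Sat? π i φ ⊎-dec Sat? π i ψ
  Sat? π i (dia ρ φ) =
    map′ (λ (j , x , s) → j , proj₁ (inL-within π ρ x) , x , s) (λ (j , _ , x , s) → j , x , s)
         (∃-bounded? _ (inL-bound π ρ ∘ proj₁) λ j → InL? π i j ρ ×-dec Sat? π j φ)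
  Sat? π i (box ρ φ) =
    map′ (λ h j _ → h j) (λ h j x → h j (proj₁ (inL-within π ρ x)) x)
         (∀-bounded? _ (inL-bound π ρ) (λ j → InL? π i j ρ) (λ j → Sat? π j φ))

  InL? : ∀ {n} (π : Trace n) i j ρ → Dec (InL π i j ρ)
  InL? π i j (prop φ) with j ≟ suc i | i <? length π
  ... | no j≢1+i | _ = no (j≢1+i ∘ proj₁)
  ... | yes _ | no i≮L = no (i≮L ∘ proj₁ ∘ proj₂)
  ... | yes j≡1+i | yes i<L =
    map′ (λ p → j≡1+i , i<L , p)
         (λ (_ , i<L′ , p) → subst (λ lt → lookup π (fromℕ< lt) ⊨p φ) (<-irrelevant i<L′ i<L) p)
         (lookup π (fromℕ< i<L) ⊨p? φ)
  InL? π i j (test φ) = (j ≟ i) ×-dec Sat? π i φ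
  InL? π i j (ρ₁ +ₚ ρ₂) = InL? π i j ρ₁ ⊎-dec InL? π i j ρ₂
  InL? π i j (ρ₁ ⨾ₚ ρ₂) =
    ∃-bounded? _ (inL-bound π ρ₁ ∘ proj₁) λ k → InL? π i k ρ₁ ×-dec InL? π k j ρ₂
  InL? π i j (star ρ) =
    map′ forget-progress (drop-loops (proj₁ ∘ inL-within π ρ))
         (progress? (λ a b → InL? π a b ρ) (j ∸ i) i j ≤-refl)

drop-lookup : ∀ {A : Set} (xs : List A) i (i<L : i < length xs) →
              drop i xs ≡ lookup xs (fromℕ< i<L) ∷ drop (suc i) xs
drop-lookup (x ∷ xs) zero (s≤s _) = refl
drop-lookup (x ∷ xs) (suc i) (s≤s i<L) = drop-lookup xs i i<L

drop-∷ : ∀ {A : Set} (xs : List A) i {y ys} → drop i xs ≡ y ∷ ys →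
         Σ (i < length xs) λ i<L → lookup xs (fromℕ< i<L) ≡ y
drop-∷ (x ∷ xs) zero refl = s≤s z≤n , refl
drop-∷ (x ∷ xs) (suc i) eq with drop-∷ xs i eq
... | i<L , x≡y = s≤s i<L , x≡y

++-glue : ∀ {A : Set} {xs ys : List A} σ₁ σ₂ rest →
          xs ≡ σ₁ ++ ys → ys ≡ σ₂ ++ rest → xs ≡ (σ₁ ++ σ₂) ++ rest
++-glue σ₁ σ₂ rest e₁ e₂ = trans e₁ (trans (cong (σ₁ ++_) e₂) (sym (++-assoc σ₁ σ₂ rest)))

drop-length-++ : ∀ {A : Set} (σ rest : List A) → drop (length σ) (σ ++ rest) ≡ rest
drop-length-++ [] rest = refl
drop-length-++ (x ∷ σ) rest = drop-length-++ σ rest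

drop-split : ∀ {A : Set} (xs : List A) i σ₁ σ₂ rest → drop i xs ≡ (σ₁ ++ σ₂) ++ rest →
             drop i xs ≡ σ₁ ++ (σ₂ ++ rest) × drop (i + length σ₁) xs ≡ σ₂ ++ rest
drop-split xs i σ₁ σ₂ rest e = e′ , (begin
    drop (i + length σ₁) xs              ≡⟨ drop-drop i (length σ₁) xs ⟨
    drop (length σ₁) (drop i xs)         ≡⟨ cong (drop (length σ₁)) e′ ⟩
    drop (length σ₁) (σ₁ ++ σ₂ ++ rest)  ≡⟨ drop-length-++ σ₁ (σ₂ ++ rest) ⟩
    σ₂ ++ rest                           ∎)
  where
  open ≡-Reasoning
  e′ : drop i xs ≡ σ₁ ++ (σ₂ ++ rest)
  e′ = trans e (++-assoc σ₁ σ₂ rest)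

+-length-++ : ∀ {A : Set} i (σ₁ σ₂ : List A) → i + length σ₁ + length σ₂ ≡ i + length (σ₁ ++ σ₂)
+-length-++ i σ₁ σ₂ = trans (+-assoc i (length σ₁) (length σ₂)) (cong (i +_) (sym (length-++ σ₁)))

mutual
  path-sound : ∀ {n} (π : Trace n) {i j} r → InL π i j (toPath r) →
               Σ (Trace n) λ σ → InRE r σ × drop i π ≡ σ ++ drop j π
  path-sound π {i} (rprop φ) (refl , i<L , p) =
    lookup π (fromℕ< i<L) ∷ [] , (_ , refl , p) , drop-lookup π i i<L
  path-sound π (r₁ +ᵣ r₂) (inj₁ x) with path-sound π r₁ x
  ... | σ , w , e = σ , inj₁ w , e
  path-sound π (r₁ +ᵣ r₂) (inj₂ x) with path-sound π r₂ x
  ... | σ , w , e = σ , inj₂ w , e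
  path-sound π (r₁ ⨾ᵣ r₂) (k , x , y) with path-sound π r₁ x | path-sound π r₂ y
  ... | σ₁ , w₁ , e₁ | σ₂ , w₂ , e₂ =
    σ₁ ++ σ₂ , (σ₁ , σ₂ , refl , w₁ , w₂) , ++-glue σ₁ σ₂ _ e₁ e₂
  path-sound π (rstar r) s = star-sound π r s

  star-sound : ∀ {n} (π : Trace n) r {i j} → Star (λ a b → InL π a b (toPath r)) i j →
               Σ (Trace n) λ σ → StarL (InRE r) σ × drop i π ≡ σ ++ drop j π
  star-sound π r ε = [] , nil , refl
  star-sound π r (x ◅ s) with path-sound π r x | star-sound π r s
  ... | σ₁ , w₁ , e₁ | σ₂ , w₂ , e₂ = σ₁ ++ σ₂ , cons σ₁ σ₂ w₁ w₂ , ++-glue σ₁ σ₂ _ e₁ e₂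

mutual
  path-complete : ∀ {n} (π : Trace n) i r σ rest → InRE r σ → drop i π ≡ σ ++ rest →
                  InL π i (i + length σ) (toPath r)
  path-complete π i (rprop φ) σ rest (Π , refl , p) e with drop-∷ π i e
  ... | i<L , x≡Π = +-comm i 1 , i<L , subst (_⊨p φ) (sym x≡Π) p
  path-complete π i (r₁ +ᵣ r₂) σ rest (inj₁ w) e = inj₁ (path-complete π i r₁ σ rest w e)
  path-complete π i (r₁ +ᵣ r₂) σ rest (inj₂ w) e = inj₂ (path-complete π i r₂ σ rest w e)
  path-complete π i (r₁ ⨾ᵣ r₂) σ rest (σ₁ , σ₂ , refl , w₁ , w₂) e
    with drop-split π i σ₁ σ₂ rest e
  ... | e₁ , e₂ =
    i + length σ₁ , path-complete π i r₁ σ₁ (σ₂ ++ rest) w₁ e₁ ,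
    subst (λ j → InL π (i + length σ₁) j (toPath r₂)) (+-length-++ i σ₁ σ₂)
          (path-complete π (i + length σ₁) r₂ σ₂ rest w₂ e₂)
  path-complete π i (rstar r) σ rest s e = star-complete π i r σ rest s e

  star-complete : ∀ {n} (π : Trace n) i r σ rest → StarL (InRE r) σ → drop i π ≡ σ ++ rest →
                  Star (λ a b → InL π a b (toPath r)) i (i + length σ)
  star-complete π i r .[] rest nil e = subst (Star _ i) (sym (+-identityʳ i)) ε
  star-complete π i r .(σ₁ ++ σ₂) rest (cons σ₁ σ₂ w s) e with drop-split π i σ₁ σ₂ rest e
  ... | e₁ , e₂ =
    path-complete π i r σ₁ (σ₂ ++ rest) w e₁ ◅
    subst (Star _ (i + length σ₁)) (+-length-++ i σ₁ σ₂)
          (star-complete π (i + length σ₁) r σ₂ rest s e₂)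

end-at-length : ∀ {n} (π : Trace n) → Sat π (length π) end
end-at-length π _ _ (_ , L<L , _) = <-irrefl refl L<L

end⇒drop≡[] : ∀ {n} (π : Trace n) j → Sat π j end → drop j π ≡ []
end⇒drop≡[] π j e with drop j π in eq
... | [] = refl
... | _ ∷ _ with drop-∷ π j eq
...   | j<L , _ = ⊥-elim (e (suc j) (n≤1+n j) (refl , j<L , ⋆))

dia-end⇔InRE : ∀ {n} (π : Trace n) r → π ⊨ dia (toPath r) end ⇔ InRE r π
dia-end⇔InRE π r = mk⇔ sound complete
  where
  sound : π ⊨ dia (toPath r) end → InRE r π
  sound (j , _ , x , e) with path-sound π r x
  ... | σ , w , π≡σ++rest = subst (InRE r) (sym π≡σ) w
    where
    open ≡-Reasoning
    π≡σ : π ≡ σ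
    π≡σ = begin
      π               ≡⟨ π≡σ++rest ⟩
      σ ++ drop j π   ≡⟨ cong (σ ++_) (end⇒drop≡[] π j e) ⟩
      σ ++ []         ≡⟨ ++-identityʳ σ ⟩
      σ               ∎

  complete : InRE r π → π ⊨ dia (toPath r) end
  complete w = length π , z≤n , path-complete π 0 r π [] w (sym (++-identityʳ π)) , end-at-length π

-- Necessarily good = possibly good and not possibly good for the negation;
-- the backward direction uses stability of the decidable Sat.
necGood⇔ : ∀ {n} (φ : Form n) π → NecGood φ π ⇔ (PossGood φ π × ¬ PossGood (neg φ) π)
necGood⇔ φ π = mk⇔
  (λ nec → ([] , nec []) , λ (π′ , ¬sat) → ¬sat (nec π′))
  (λ (_ , ¬poss¬) π′ → decidable-stable (Sat? (π ++ π′) 0 φ) λ ¬sat → ¬poss¬ (π′ , ¬sat))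

theorem2 : (n : ℕ) (φ : Form n) (prefφ pref¬φ : RE n) →
    ((π : Trace n) → InRE prefφ π ⇔ PossGood φ π) →
    ((π : Trace n) → InRE pref¬φ π ⇔ PossGood (neg φ) π) →
    (π : Trace n) →
    (PossGood φ π ⇔ π ⊨ dia (toPath prefφ) end)
    × (NecGood φ π ⇔ π ⊨ and (dia (toPath prefφ) end) (neg (dia (toPath pref¬φ) end)))
theorem2 n φ prefφ pref¬φ prefφ-spec pref¬φ-spec π = possGoodφ , necGoodφ
  where
  possGoodφ : PossGood φ π ⇔ π ⊨ dia (toPath prefφ) end
  possGoodφ = ⇔-sym (prefφ-spec π ⇔-∘ dia-end⇔InRE π prefφ)

  possGood¬φ : PossGood (neg φ) π ⇔ π ⊨ dia (toPath pref¬φ) end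
  possGood¬φ = ⇔-sym (pref¬φ-spec π ⇔-∘ dia-end⇔InRE π pref¬φ)

  necGoodφ : NecGood φ π ⇔ π ⊨ and (dia (toPath prefφ) end) (neg (dia (toPath pref¬φ) end))
  necGoodφ = (possGoodφ ×-⇔ ¬-⇔ possGood¬φ) ⇔-∘ necGood⇔ φ π
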